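{- Let $\mathcal{A}$ be the toric arrangement in $(\mathbb{C}^*)^2$ (coordinates $t_1,t_2$) consisting of $H_1=\{t_1=1\}$, $H_2=\{t_2=1\}$, $H_3=\{t_1t_2=1\}$. Let $\omega_1,\omega_2,\omega_3,\psi_1,\psi_2$ be the cohomology classes of the closed forms \[\omega_1=\tfrac{1}{2\pi\sqrt{ -1}}\,d\log(1-t_1),\ \omega_2=\tfrac{1}{2\pi\sqrt{ -1}}\,d\log(1-t_2),\ \omega_3=\tfrac{1}{2\pi\sqrt{ -1}}\,d\log(1-t_1t_2),\] \[\psi_1=\tfrac{1}{2\pi\sqrt{ -1}}\,d\log t_1,\ \psi_2=\tfrac{1}{2\pi\sqrt{ -1}}\,d\log t_2\] (these form a basis of $H^1(M(\mathcal{A});\mathbb{Q})$). Then the first resonance variety $\mathcal{R}^1(\mathcal{A};\mathbb{Q})$ is the union of the following five planes of $H^1(M(\mathcal{A});\mathbb{Q})$: \[P_1=\langle\omega_1,\psi_1\rangle,\ P_2=\langle\omega_2,\psi_2\rangle,\ P_3=\langle\omega_3,\psi_1+\psi_2\rangle,\] \[P_4=\langle\omega_1-\omega_3,\ \omega_1-\omega_2-\psi_1\rangle,\ P_5=\langle\omega_2-\omega_3,\ \omega_1-\omega_2+\psi_2\rangle.\]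
   Context: $M(\mathcal{A})=(\mathbb{C}^*)^2\setminus(H_1\cup H_2\cup H_3)$. For a graded-commutative $R$-algebra $A=\bigoplus_k A^k$ and $\alpha\in A^1$, left multiplication $\delta_\alpha:A^i\to A^{i+1}$ makes $(A,\delta_\alpha)$ a complex; the $k$-th resonance variety is $\mathcal{R}^k(A)=\{\alpha\in A^1 : H^k(A,\delta_\alpha)\neq 0\}$, and for a toric arrangement $\mathcal{R}^k(\mathcal{A};R)=\mathcal{R}^k(H^\bullet(M(\mathcal{A});R))$. -}

module Defs where

open import Data.Rational using (ℚ; 0ℚ; 1ℚ; _+_; _*_; _-_; -_)
open import Data.Vec using (Vec; []; _∷_; zipWith; map)
open import Data.Product using (Σ; ∃; _×_; _,_)
open import Data.Sum using (_⊎_)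
open import Relation.Binary.PropositionalEquality using (_≡_)
open import Relation.Nullary using (¬_)

-- Coordinates: H¹(M(𝒜);ℚ) ≅ ℚ⁵ in the ordered basis (ω₁, ω₂, ω₃, ψ₁, ψ₂).
A¹ : Set
A¹ = Vec ℚ 5

-- Λ²(ℚ⁵) in the basis e_i ∧ e_j (i < j), ordered
-- 01,02,03,04,12,13,14,23,24,34.
Λ² : Set
Λ² = Vec ℚ 10

_⊕_ : ∀ {n} → Vec ℚ n → Vec ℚ n → Vec ℚ n
_⊕_ = zipWith _+_
infixl 6 _⊕_

_·_ : ∀ {n} → ℚ → Vec ℚ n → Vec ℚ n
c · v = map (c *_) v
infixl 7 _·_

ω₁ ω₂ ω₃ ψ₁ ψ₂ : A¹
ω₁ = 1ℚ ∷ 0ℚ ∷ 0ℚ ∷ 0ℚ ∷ 0ℚ ∷ []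
ω₂ = 0ℚ ∷ 1ℚ ∷ 0ℚ ∷ 0ℚ ∷ 0ℚ ∷ []
ω₃ = 0ℚ ∷ 0ℚ ∷ 1ℚ ∷ 0ℚ ∷ 0ℚ ∷ []
ψ₁ = 0ℚ ∷ 0ℚ ∷ 0ℚ ∷ 1ℚ ∷ 0ℚ ∷ []
ψ₂ = 0ℚ ∷ 0ℚ ∷ 0ℚ ∷ 0ℚ ∷ 1ℚ ∷ []

_⊖_ : A¹ → A¹ → A¹
u ⊖ v = u ⊕ ((- 1ℚ) · v)
infixl 6 _⊖_

_∧_ : A¹ → A¹ → Λ²
(a0 ∷ a1 ∷ a2 ∷ a3 ∷ a4 ∷ []) ∧ (b0 ∷ b1 ∷ b2 ∷ b3 ∷ b4 ∷ []) =
  m a0 a1 b0 b1 ∷ m a0 a2 b0 b2 ∷ m a0 a3 b0 b3 ∷ m a0 a4 b0 b4 ∷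
  m a1 a2 b1 b2 ∷ m a1 a3 b1 b3 ∷ m a1 a4 b1 b4 ∷
  m a2 a3 b2 b3 ∷ m a2 a4 b2 b4 ∷
  m a3 a4 b3 b4 ∷ []
  where
  m : ℚ → ℚ → ℚ → ℚ → ℚ
  m ai aj bi bj = ai * bj - aj * bi
infixr 8 _∧_

-- Relations of H²(M(𝒜);ℚ) = Λ²(A¹) / ⟨ρ₁,ρ₂,ρ₃,ρ₄⟩ :
--   ρ₁ = ω₁ψ₁,  ρ₂ = ω₂ψ₂,  ρ₃ = ω₃(ψ₁+ψ₂),
--   ρ₄ = ω₁ω₂ − ω₁ω₃ + ω₂ω₃ − ω₃ψ₁
ρ₁ ρ₂ ρ₃ ρ₄ : Λ²
ρ₁ = ω₁ ∧ ψ₁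
ρ₂ = ω₂ ∧ ψ₂
ρ₃ = ω₃ ∧ (ψ₁ ⊕ ψ₂)
ρ₄ = ((ω₁ ∧ ω₂) ⊕ ((- 1ℚ) · (ω₁ ∧ ω₃))) ⊕ ((ω₂ ∧ ω₃) ⊕ ((- 1ℚ) · (ω₃ ∧ ψ₁)))

IsZero² : Λ² → Set
IsZero² v = Σ ℚ λ c₁ → Σ ℚ λ c₂ → Σ ℚ λ c₃ → Σ ℚ λ c₄ →
  v ≡ ((c₁ · ρ₁) ⊕ (c₂ · ρ₂)) ⊕ ((c₃ · ρ₃) ⊕ (c₄ · ρ₄))

-- The Aomoto complex A⁰ →δ_α A¹ →δ_α A², δ_α x = α·x.
-- β ∈ ker(δ_α : A¹ → A²)
InKer¹ : A¹ → A¹ → Set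
InKer¹ α β = IsZero² (α ∧ β)

-- β ∈ im(δ_α : A⁰ = ℚ → A¹)
InIm⁰ : A¹ → A¹ → Set
InIm⁰ α β = Σ ℚ λ λ₀ → β ≡ λ₀ · α

H¹NonZero : A¹ → Set
H¹NonZero α = Σ A¹ λ β → InKer¹ α β × ¬ InIm⁰ α β

InR¹ : A¹ → Set
InR¹ α = H¹NonZero α

InPlane : A¹ → A¹ → A¹ → Set
InPlane u v α = Σ ℚ λ a → Σ ℚ λ b → α ≡ (a · u) ⊕ (b · v)

InUnionOfPlanes : A¹ → Set
InUnionOfPlanes α =
  InPlane ω₁ ψ₁ α ⊎
  InPlane ω₂ ψ₂ α ⊎
  InPlane ω₃ (ψ₁ ⊕ ψ₂) α ⊎
  InPlane (ω₁ ⊖ ω₃) ((ω₁ ⊖ ω₂) ⊖ ψ₁) α ⊎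
  InPlane (ω₂ ⊖ ω₃) ((ω₁ ⊖ ω₂) ⊕ ψ₂) α

{-# OPTIONS --safe #-}
-- A witness β ∉ ℚα for α ∈ 𝓡¹ has α ∧ β in the relation space R = ⟨ρ₁, ρ₂, ρ₃, ρ₄⟩ ⊆ Λ²(ℚ⁵).
-- If α ∧ β = 0 then α = 0, as β ∉ ℚα. Otherwise α ∧ β is a nonzero decomposable element of R;
-- the Plücker relations cut the decomposable elements of R down to five lines, spanned by the
-- bivectors u ∧ v of the five planes ⟨u, v⟩, and α ∧ (α ∧ β) = 0 then puts α into the matching
-- plane. Conversely, for α ∈ ⟨u, v⟩ every β ∈ ⟨u, v⟩ has α ∧ β ∈ ℚ (u ∧ v) ⊆ R, and since
-- u ∧ v ≠ 0 such a β can be chosen outside ℚα.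
module Submission where

open import Data.Empty using (⊥-elim)
open import Data.Fin.Base using (zero; suc)
open import Data.List.Base using (List; []; _∷_; _++_)
open import Data.Maybe.Base using (Maybe; just; nothing)
open import Data.Product using (∃-syntax; _×_; _,_)
open import Data.Rational.Base using (ℚ; 0ℚ; 1ℚ; _+_; _*_; _-_; -_; 1/_; ≢-nonZero)
open import Data.Rational.Properties
  using (_≟_; +-*-commutativeRing; +-identityˡ; *-assoc; *-comm; *-identityˡ; *-inverseʳ; *-inverseˡ;
         *-zeroˡ; *-zeroʳ; *-distribˡ-+; 1≢0)
open import Data.Sum using (_⊎_; inj₁; inj₂)
open import Data.Vec.Base using (Vec; []; _∷_; lookup; replicate; toList)
open import Data.Vec.Properties using (∷-injective)
open import Data.Vec.Relation.Binary.Pointwise.Inductive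
  using (Pointwise; []; _∷_; Pointwise-≡⇒≡; ≡⇒Pointwise-≡)
open import Function.Bundles using (_⇔_; mk⇔)
open import Level using (0ℓ)
open import Relation.Binary.PropositionalEquality
open import Relation.Nullary using (¬_; yes; no)
open import Tactic.RingSolver using (solve; solve-∀)
open import Tactic.RingSolver.Core.AlmostCommutativeRing
  using (AlmostCommutativeRing; fromCommutativeRing)

open import Defs

-- Without the zero test the solver cannot discard monomials whose coefficient is 0ℚ.
ℚ-ring : AlmostCommutativeRing 0ℓ 0ℓ
ℚ-ring = fromCommutativeRing +-*-commutativeRing 0≟
  where
  0≟ : (p : ℚ) → Maybe (0ℚ ≡ p)
  0≟ p with p ≟ 0ℚ
  ... | yes refl = just refl
  ... | no _     = nothing

*-cancelˡ-≡ : ∀ {p q r} → p ≢ 0ℚ → p * q ≡ p * r → q ≡ r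
*-cancelˡ-≡ {p} {q} {r} p≢0 pq≡pr = begin
  q              ≡⟨ sym (*-identityˡ q) ⟩
  1ℚ * q         ≡⟨ cong (_* q) (sym (*-inverseˡ p)) ⟩
  (1/ p * p) * q ≡⟨ *-assoc (1/ p) p q ⟩
  1/ p * (p * q) ≡⟨ cong (1/ p *_) pq≡pr ⟩
  1/ p * (p * r) ≡⟨ sym (*-assoc (1/ p) p r) ⟩
  (1/ p * p) * r ≡⟨ cong (_* r) (*-inverseˡ p) ⟩
  1ℚ * r         ≡⟨ *-identityˡ r ⟩
  r              ∎
  where
  open ≡-Reasoning
  instance _ = ≢-nonZero p≢0

*-cancelʳ-≡ : ∀ {p q r} → r ≢ 0ℚ → p * r ≡ q * r → p ≡ q
*-cancelʳ-≡ {p} {q} {r} r≢0 pr≡qr = *-cancelˡ-≡ r≢0 (trans (*-comm r p) (trans pr≡qr (*-comm q r)))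

vanishing⇒≡ : ∀ {p e q r} → p ≢ 0ℚ → e ≡ 0ℚ → e ≡ p * (q - r) → q ≡ r
vanishing⇒≡ {p} {e} {q} {r} p≢0 e≡0 e≡p[q-r] = *-cancelˡ-≡ p≢0 (begin
  p * q               ≡⟨ solve vars ℚ-ring ⟩
  p * (q - r) + p * r ≡⟨ cong (_+ p * r) (trans (sym e≡p[q-r]) e≡0) ⟩
  0ℚ + p * r          ≡⟨ +-identityˡ (p * r) ⟩
  p * r               ∎)
  where
  open ≡-Reasoning
  vars : List ℚ
  vars = p ∷ q ∷ r ∷ []

0⃗ : ∀ {n} → Vec ℚ n
0⃗ = replicate _ 0ℚ

·-distribˡ-⊕ : ∀ {n} k (x y : Vec ℚ n) → k · (x ⊕ y) ≡ k · x ⊕ k · y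
·-distribˡ-⊕ k []       []       = refl
·-distribˡ-⊕ k (x ∷ xs) (y ∷ ys) = cong₂ _∷_ (*-distribˡ-+ k x y) (·-distribˡ-⊕ k xs ys)

·-assoc : ∀ {n} k a (x : Vec ℚ n) → k · (a · x) ≡ (k * a) · x
·-assoc k a []       = refl
·-assoc k a (x ∷ xs) = cong₂ _∷_ (sym (*-assoc k a x)) (·-assoc k a xs)

·-linear : ∀ {n} k a b (x y : Vec ℚ n) → k · (a · x ⊕ b · y) ≡ (k * a) · x ⊕ (k * b) · y
·-linear k a b x y = trans (·-distribˡ-⊕ k (a · x) (b · y)) (cong₂ _⊕_ (·-assoc k a x) (·-assoc k b y))

·-cancelʳ : ∀ {n p q} {w : Vec ℚ n} → w ≢ 0⃗ → p · w ≡ q · w → p ≡ q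
·-cancelʳ {w = []}     w≢0 _  = ⊥-elim (w≢0 refl)
·-cancelʳ {w = x ∷ xs} w≢0 pw≡qw with ∷-injective pw≡qw | x ≟ 0ℚ
... | px≡qx , _      | no x≢0   = *-cancelʳ-≡ x≢0 px≡qx
... | _     , pxs≡qxs | yes refl = ·-cancelʳ (λ xs≡0 → w≢0 (cong (0ℚ ∷_) xs≡0)) pxs≡qxs

zero-or-pivot : ∀ {n} (x : Vec ℚ n) → x ≡ 0⃗ ⊎ ∃[ i ] lookup x i ≢ 0ℚ
zero-or-pivot []       = inj₁ refl
zero-or-pivot (x ∷ xs) with x ≟ 0ℚ | zero-or-pivot xs
... | no x≢0  | _                = inj₂ (zero , x≢0)
... | yes refl | inj₁ refl        = inj₁ refl
... | yes refl | inj₂ (i , xᵢ≢0) = inj₂ (suc i , xᵢ≢0)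

proportional-if-pivot : ∀ {n a b} {xs ys : Vec ℚ n} →
                        a ≢ 0ℚ → Pointwise (λ x y → a * y ≡ x * b) xs ys → ∃[ l ] ys ≡ l · xs
proportional-if-pivot {a = a} {b} a≢0 minors = 1/ a * b , scaled minors
  where
  instance _ = ≢-nonZero a≢0
  open ≡-Reasoning
  a[a⁻¹b]≡b : a * (1/ a * b) ≡ b
  a[a⁻¹b]≡b = trans (sym (*-assoc a (1/ a) b)) (trans (cong (_* b) (*-inverseʳ a)) (*-identityˡ b))
  scaled : ∀ {n} {xs ys : Vec ℚ n} → Pointwise (λ x y → a * y ≡ x * b) xs ys → ys ≡ (1/ a * b) · xs
  scaled []                                   = refl
  scaled {xs = x ∷ _} {y ∷ _} (ay≡xb ∷ rest) = cong₂ _∷_ (*-cancelˡ-≡ a≢0 (begin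
    a * y              ≡⟨ ay≡xb ⟩
    x * b              ≡⟨ *-comm x b ⟩
    b * x              ≡⟨ cong (_* x) (sym a[a⁻¹b]≡b) ⟩
    a * (1/ a * b) * x ≡⟨ *-assoc a (1/ a * b) x ⟩
    a * (1/ a * b * x) ∎)) (scaled rest)

Λ³ : Set
Λ³ = Vec ℚ 10

-- The product A¹ × Λ² → Λ³, in the basis e_i ∧ e_j ∧ e_k (i < j < k) ordered lexicographically.
infixr 8 _⋏_
_⋏_ : A¹ → Λ² → Λ³
(a₀ ∷ a₁ ∷ a₂ ∷ a₃ ∷ a₄ ∷ []) ⋏ (p₀₁ ∷ p₀₂ ∷ p₀₃ ∷ p₀₄ ∷ p₁₂ ∷ p₁₃ ∷ p₁₄ ∷ p₂₃ ∷ p₂₄ ∷ p₃₄ ∷ []) =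
  a₀ * p₁₂ - a₁ * p₀₂ + a₂ * p₀₁ ∷ a₀ * p₁₃ - a₁ * p₀₃ + a₃ * p₀₁ ∷ a₀ * p₁₄ - a₁ * p₀₄ + a₄ * p₀₁ ∷
  a₀ * p₂₃ - a₂ * p₀₃ + a₃ * p₀₂ ∷ a₀ * p₂₄ - a₂ * p₀₄ + a₄ * p₀₂ ∷ a₀ * p₃₄ - a₃ * p₀₄ + a₄ * p₀₃ ∷
  a₁ * p₂₃ - a₂ * p₁₃ + a₃ * p₁₂ ∷ a₁ * p₂₄ - a₂ * p₁₄ + a₄ * p₁₂ ∷ a₁ * p₃₄ - a₃ * p₁₄ + a₄ * p₁₃ ∷
  a₂ * p₃₄ - a₃ * p₂₄ + a₄ * p₂₃ ∷ []

plücker : Λ² → Vec ℚ 5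
plücker (p₀₁ ∷ p₀₂ ∷ p₀₃ ∷ p₀₄ ∷ p₁₂ ∷ p₁₃ ∷ p₁₄ ∷ p₂₃ ∷ p₂₄ ∷ p₃₄ ∷ []) =
  p₀₁ * p₂₃ - p₀₂ * p₁₃ + p₀₃ * p₁₂ ∷ p₀₁ * p₂₄ - p₀₂ * p₁₄ + p₀₄ * p₁₂ ∷
  p₀₁ * p₃₄ - p₀₃ * p₁₄ + p₀₄ * p₁₃ ∷ p₀₂ * p₃₄ - p₀₃ * p₂₄ + p₀₄ * p₂₃ ∷
  p₁₂ * p₃₄ - p₁₃ * p₂₄ + p₁₄ * p₂₃ ∷ []

incidence-identity : ∀ aᵢ aⱼ aₖ bᵢ bⱼ bₖ →
  aᵢ * (aⱼ * bₖ - aₖ * bⱼ) - aⱼ * (aᵢ * bₖ - aₖ * bᵢ) + aₖ * (aᵢ * bⱼ - aⱼ * bᵢ) ≡ 0ℚ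
incidence-identity = solve-∀ ℚ-ring

plücker-identity : ∀ aᵢ aⱼ aₖ aₗ bᵢ bⱼ bₖ bₗ →
  (aᵢ * bⱼ - aⱼ * bᵢ) * (aₖ * bₗ - aₗ * bₖ) - (aᵢ * bₖ - aₖ * bᵢ) * (aⱼ * bₗ - aₗ * bⱼ)
    + (aᵢ * bₗ - aₗ * bᵢ) * (aⱼ * bₖ - aₖ * bⱼ) ≡ 0ℚ
plücker-identity = solve-∀ ℚ-ring

minor-of-combinations : ∀ a b c d uᵢ uⱼ vᵢ vⱼ →
  (a * uᵢ + b * vᵢ) * (c * uⱼ + d * vⱼ) - (a * uⱼ + b * vⱼ) * (c * uᵢ + d * vᵢ)
    ≡ (a * d - b * c) * (uᵢ * vⱼ - uⱼ * vᵢ)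
minor-of-combinations = solve-∀ ℚ-ring

⋏-∧-self : ∀ α β → α ⋏ (α ∧ β) ≡ 0⃗
⋏-∧-self (a₀ ∷ a₁ ∷ a₂ ∷ a₃ ∷ a₄ ∷ []) (b₀ ∷ b₁ ∷ b₂ ∷ b₃ ∷ b₄ ∷ []) = Pointwise-≡⇒≡
  ( incidence-identity a₀ a₁ a₂ b₀ b₁ b₂ ∷ incidence-identity a₀ a₁ a₃ b₀ b₁ b₃
  ∷ incidence-identity a₀ a₁ a₄ b₀ b₁ b₄ ∷ incidence-identity a₀ a₂ a₃ b₀ b₂ b₃
  ∷ incidence-identity a₀ a₂ a₄ b₀ b₂ b₄ ∷ incidence-identity a₀ a₃ a₄ b₀ b₃ b₄
  ∷ incidence-identity a₁ a₂ a₃ b₁ b₂ b₃ ∷ incidence-identity a₁ a₂ a₄ b₁ b₂ b₄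
  ∷ incidence-identity a₁ a₃ a₄ b₁ b₃ b₄ ∷ incidence-identity a₂ a₃ a₄ b₂ b₃ b₄ ∷ [])

plücker-∧ : ∀ α β → plücker (α ∧ β) ≡ 0⃗
plücker-∧ (a₀ ∷ a₁ ∷ a₂ ∷ a₃ ∷ a₄ ∷ []) (b₀ ∷ b₁ ∷ b₂ ∷ b₃ ∷ b₄ ∷ []) = Pointwise-≡⇒≡
  ( plücker-identity a₀ a₁ a₂ a₃ b₀ b₁ b₂ b₃ ∷ plücker-identity a₀ a₁ a₂ a₄ b₀ b₁ b₂ b₄
  ∷ plücker-identity a₀ a₁ a₃ a₄ b₀ b₁ b₃ b₄ ∷ plücker-identity a₀ a₂ a₃ a₄ b₀ b₂ b₃ b₄
  ∷ plücker-identity a₁ a₂ a₃ a₄ b₁ b₂ b₃ b₄ ∷ [])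

∧-of-combinations : ∀ a b c d u v → (a · u ⊕ b · v) ∧ (c · u ⊕ d · v) ≡ (a * d - b * c) · (u ∧ v)
∧-of-combinations a b c d (u₀ ∷ u₁ ∷ u₂ ∷ u₃ ∷ u₄ ∷ []) (v₀ ∷ v₁ ∷ v₂ ∷ v₃ ∷ v₄ ∷ []) = Pointwise-≡⇒≡
  ( m u₀ u₁ v₀ v₁ ∷ m u₀ u₂ v₀ v₂ ∷ m u₀ u₃ v₀ v₃ ∷ m u₀ u₄ v₀ v₄ ∷ m u₁ u₂ v₁ v₂
  ∷ m u₁ u₃ v₁ v₃ ∷ m u₁ u₄ v₁ v₄ ∷ m u₂ u₃ v₂ v₃ ∷ m u₂ u₄ v₂ v₄ ∷ m u₃ u₄ v₃ v₄ ∷ [])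
  where
  m = minor-of-combinations a b c d

∧≡0⃗⇒dependent : ∀ α β → α ∧ β ≡ 0⃗ → α ≡ 0⃗ ⊎ InIm⁰ α β
∧≡0⃗⇒dependent α@(a₀ ∷ a₁ ∷ a₂ ∷ a₃ ∷ a₄ ∷ []) β@(b₀ ∷ b₁ ∷ b₂ ∷ b₃ ∷ b₄ ∷ []) α∧β≡0
  with ≡⇒Pointwise-≡ α∧β≡0 | zero-or-pivot α
... | _ | inj₁ α≡0 = inj₁ α≡0
... | e₀₁ ∷ e₀₂ ∷ e₀₃ ∷ e₀₄ ∷ e₁₂ ∷ e₁₃ ∷ e₁₄ ∷ e₂₃ ∷ e₂₄ ∷ e₃₄ ∷ [] | inj₂ (i , aᵢ≢0) =
  inj₂ (proportional-if-pivot aᵢ≢0 (pivot i))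
  where
  vars : List ℚ
  vars = toList α ++ toList β
  SameRatio : ℚ → ℚ → Set
  SameRatio a b = Pointwise (λ x y → a * y ≡ x * b) α β
  pivot₀ : SameRatio a₀ b₀
  pivot₀ = refl
         ∷ vanishing⇒≡ 1≢0 e₀₁ (solve vars ℚ-ring) ∷ vanishing⇒≡ 1≢0 e₀₂ (solve vars ℚ-ring)
         ∷ vanishing⇒≡ 1≢0 e₀₃ (solve vars ℚ-ring) ∷ vanishing⇒≡ 1≢0 e₀₄ (solve vars ℚ-ring) ∷ []
  pivot₁ : SameRatio a₁ b₁
  pivot₁ = sym (vanishing⇒≡ 1≢0 e₀₁ (solve vars ℚ-ring))
         ∷ refl
         ∷ vanishing⇒≡ 1≢0 e₁₂ (solve vars ℚ-ring) ∷ vanishing⇒≡ 1≢0 e₁₃ (solve vars ℚ-ring)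
         ∷ vanishing⇒≡ 1≢0 e₁₄ (solve vars ℚ-ring) ∷ []
  pivot₂ : SameRatio a₂ b₂
  pivot₂ = sym (vanishing⇒≡ 1≢0 e₀₂ (solve vars ℚ-ring)) ∷ sym (vanishing⇒≡ 1≢0 e₁₂ (solve vars ℚ-ring))
         ∷ refl
         ∷ vanishing⇒≡ 1≢0 e₂₃ (solve vars ℚ-ring) ∷ vanishing⇒≡ 1≢0 e₂₄ (solve vars ℚ-ring) ∷ []
  pivot₃ : SameRatio a₃ b₃
  pivot₃ = sym (vanishing⇒≡ 1≢0 e₀₃ (solve vars ℚ-ring)) ∷ sym (vanishing⇒≡ 1≢0 e₁₃ (solve vars ℚ-ring))
         ∷ sym (vanishing⇒≡ 1≢0 e₂₃ (solve vars ℚ-ring))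
         ∷ refl
         ∷ vanishing⇒≡ 1≢0 e₃₄ (solve vars ℚ-ring) ∷ []
  pivot₄ : SameRatio a₄ b₄
  pivot₄ = sym (vanishing⇒≡ 1≢0 e₀₄ (solve vars ℚ-ring)) ∷ sym (vanishing⇒≡ 1≢0 e₁₄ (solve vars ℚ-ring))
         ∷ sym (vanishing⇒≡ 1≢0 e₂₄ (solve vars ℚ-ring)) ∷ sym (vanishing⇒≡ 1≢0 e₃₄ (solve vars ℚ-ring))
         ∷ refl ∷ []
  pivot : ∀ i → SameRatio (lookup α i) (lookup β i)
  pivot zero                          = pivot₀
  pivot (suc zero)                    = pivot₁
  pivot (suc (suc zero))              = pivot₂
  pivot (suc (suc (suc zero)))        = pivot₃
  pivot (suc (suc (suc (suc zero)))) = pivot₄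

relation : ℚ → ℚ → ℚ → ℚ → Λ²
relation c₁ c₂ c₃ c₄ = c₄ ∷ - c₄ ∷ c₁ ∷ 0ℚ ∷ c₄ ∷ 0ℚ ∷ c₂ ∷ c₃ - c₄ ∷ c₃ ∷ 0ℚ ∷ []

relation-expansion : ∀ c₁ c₂ c₃ c₄ → (c₁ · ρ₁ ⊕ c₂ · ρ₂) ⊕ (c₃ · ρ₃ ⊕ c₄ · ρ₄) ≡ relation c₁ c₂ c₃ c₄
relation-expansion c₁ c₂ c₃ c₄ = Pointwise-≡⇒≡
  ( solve cs ℚ-ring ∷ solve cs ℚ-ring ∷ solve cs ℚ-ring ∷ solve cs ℚ-ring ∷ solve cs ℚ-ring
  ∷ solve cs ℚ-ring ∷ solve cs ℚ-ring ∷ solve cs ℚ-ring ∷ solve cs ℚ-ring ∷ solve cs ℚ-ring ∷ [])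
  where
  cs : List ℚ
  cs = c₁ ∷ c₂ ∷ c₃ ∷ c₄ ∷ []

·-IsZero² : ∀ k {w} → IsZero² w → IsZero² (k · w)
·-IsZero² k (c₁ , c₂ , c₃ , c₄ , refl) = k * c₁ , k * c₂ , k * c₃ , k * c₄ ,
  trans (·-distribˡ-⊕ k _ _) (cong₂ _⊕_ (·-linear k c₁ c₂ ρ₁ ρ₂) (·-linear k c₃ c₄ ρ₃ ρ₄))

-- The decomposable relations c₁ ρ₁ + c₂ ρ₂ + c₃ ρ₃ + c₄ ρ₄: zero, and on lineᵢ the nonzero multiples
-- of u ∧ v for the i-th plane ⟨u, v⟩ of the theorem.
data Decomposable : ℚ → ℚ → ℚ → ℚ → Set where
  zero  : Decomposable 0ℚ 0ℚ 0ℚ 0ℚ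
  line₁ : ∀ {k} → k ≢ 0ℚ → Decomposable k 0ℚ 0ℚ 0ℚ
  line₂ : ∀ {k} → k ≢ 0ℚ → Decomposable 0ℚ k 0ℚ 0ℚ
  line₃ : ∀ {k} → k ≢ 0ℚ → Decomposable 0ℚ 0ℚ k 0ℚ
  line₄ : ∀ {k} → k ≢ 0ℚ → Decomposable k 0ℚ 0ℚ k
  line₅ : ∀ {k} → k ≢ 0ℚ → Decomposable 0ℚ (- k) k k

plücker⇒decomposable-c₄≢0 : ∀ {c₁ c₂ c₃ c₄} → c₄ ≢ 0ℚ → plücker (relation c₁ c₂ c₃ c₄) ≡ 0⃗ →
                            Decomposable c₁ c₂ c₃ c₄
plücker⇒decomposable-c₄≢0 {c₁} {c₂} {c₃} {c₄} c₄≢0 eqs with ≡⇒Pointwise-≡ eqs | c₁ ≟ 0ℚ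
... | q₀₁₂₃ ∷ q₀₁₂₄ ∷ _ ∷ _ ∷ _ ∷ [] | yes refl with c₃ ≟ c₄ | c₂ ≟ - c₃
...   | no c₃≢c₄ | _ = ⊥-elim (c₃≢c₄ (vanishing⇒≡ c₄≢0 q₀₁₂₃ (solve cs ℚ-ring)))
  where
  cs : List ℚ
  cs = c₃ ∷ c₄ ∷ []
...   | yes refl | no c₂≢-c₃ = ⊥-elim (c₂≢-c₃ (vanishing⇒≡ c₄≢0 q₀₁₂₄ (solve cs ℚ-ring)))
  where
  cs : List ℚ
  cs = c₂ ∷ c₃ ∷ []
...   | yes refl | yes refl = line₅ c₄≢0
plücker⇒decomposable-c₄≢0 {c₁} {c₂} {c₃} {c₄} c₄≢0 eqs | q₀₁₂₃ ∷ q₀₁₂₄ ∷ _ ∷ q₀₂₃₄ ∷ _ ∷ [] | no c₁≢0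
  with c₃ ≟ 0ℚ
... | no c₃≢0 = ⊥-elim (c₃≢0 (sym (vanishing⇒≡ c₁≢0 q₀₂₃₄ (solve cs ℚ-ring))))
  where
  cs : List ℚ
  cs = c₁ ∷ c₃ ∷ c₄ ∷ []
... | yes refl with c₁ ≟ c₄ | c₂ ≟ 0ℚ
...   | no c₁≢c₄ | _ = ⊥-elim (c₁≢c₄ (vanishing⇒≡ c₄≢0 q₀₁₂₃ (solve cs ℚ-ring)))
  where
  cs : List ℚ
  cs = c₁ ∷ c₄ ∷ []
...   | yes refl | no c₂≢0 = ⊥-elim (c₂≢0 (vanishing⇒≡ c₁≢0 q₀₁₂₄ (solve cs ℚ-ring)))
  where
  cs : List ℚ
  cs = c₁ ∷ c₂ ∷ []
...   | yes refl | yes refl = line₄ c₁≢0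

plücker⇒decomposable-c₄≡0 : ∀ {c₁ c₂ c₃} → plücker (relation c₁ c₂ c₃ 0ℚ) ≡ 0⃗ → Decomposable c₁ c₂ c₃ 0ℚ
plücker⇒decomposable-c₄≡0 {c₁} {c₂} {c₃} eqs with ≡⇒Pointwise-≡ eqs | c₁ ≟ 0ℚ | c₂ ≟ 0ℚ | c₃ ≟ 0ℚ
... | _ ∷ _ ∷ q₀₁₃₄ ∷ _ ∷ _ ∷ [] | no c₁≢0 | no c₂≢0 | _ =
  ⊥-elim (c₂≢0 (sym (vanishing⇒≡ c₁≢0 q₀₁₃₄ (solve cs ℚ-ring))))
  where
  cs : List ℚ
  cs = c₁ ∷ c₂ ∷ []
... | _ ∷ _ ∷ _ ∷ q₀₂₃₄ ∷ _ ∷ [] | no c₁≢0 | yes refl | no c₃≢0 =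
  ⊥-elim (c₃≢0 (sym (vanishing⇒≡ c₁≢0 q₀₂₃₄ (solve cs ℚ-ring))))
  where
  cs : List ℚ
  cs = c₁ ∷ c₃ ∷ []
... | _ | no c₁≢0 | yes refl | yes refl = line₁ c₁≢0
... | _ ∷ _ ∷ _ ∷ _ ∷ q₁₂₃₄ ∷ [] | yes refl | no c₂≢0 | no c₃≢0 =
  ⊥-elim (c₃≢0 (vanishing⇒≡ c₂≢0 q₁₂₃₄ (solve cs ℚ-ring)))
  where
  cs : List ℚ
  cs = c₂ ∷ c₃ ∷ []
... | _ | yes refl | no c₂≢0 | yes refl = line₂ c₂≢0
... | _ | yes refl | yes refl | no c₃≢0 = line₃ c₃≢0
... | _ | yes refl | yes refl | yes refl = zero

plücker⇒decomposable : ∀ {c₁ c₂ c₃ c₄} → plücker (relation c₁ c₂ c₃ c₄) ≡ 0⃗ → Decomposable c₁ c₂ c₃ c₄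
plücker⇒decomposable {c₄ = c₄} eqs with c₄ ≟ 0ℚ
... | no c₄≢0 = plücker⇒decomposable-c₄≢0 c₄≢0 eqs
... | yes refl = plücker⇒decomposable-c₄≡0 eqs

incidence : ∀ {α β w} → α ∧ β ≡ w → α ⋏ w ≡ 0⃗
incidence {α} {β} α∧β≡w = trans (cong (α ⋏_) (sym α∧β≡w)) (⋏-∧-self α β)

-- α ⋏ (α ∧ β) = 0 yields the three linear equations of the plane; the coefficients of α are, up to
-- sign, its coordinates at two positions where one of u, v vanishes.
incidence⇒P₁ : ∀ {k α} → k ≢ 0ℚ → α ⋏ relation k 0ℚ 0ℚ 0ℚ ≡ 0⃗ → InPlane ω₁ ψ₁ α
incidence⇒P₁ {k} {α@(a₀ ∷ a₁ ∷ a₂ ∷ a₃ ∷ a₄ ∷ [])} k≢0 α⋏w≡0 with ≡⇒Pointwise-≡ α⋏w≡0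
... | _ ∷ t₀₁₃ ∷ _ ∷ t₀₂₃ ∷ _ ∷ t₀₃₄ ∷ _ = a₀ , a₃ , Pointwise-≡⇒≡
  ( solve vars ℚ-ring
  ∷ sym (vanishing⇒≡ k≢0 t₀₁₃ (solve vars ℚ-ring))
  ∷ sym (vanishing⇒≡ k≢0 t₀₂₃ (solve vars ℚ-ring))
  ∷ solve vars ℚ-ring
  ∷ vanishing⇒≡ k≢0 t₀₃₄ (solve vars ℚ-ring) ∷ [])
  where
  vars : List ℚ
  vars = k ∷ toList α

incidence⇒P₂ : ∀ {k α} → k ≢ 0ℚ → α ⋏ relation 0ℚ k 0ℚ 0ℚ ≡ 0⃗ → InPlane ω₂ ψ₂ α
incidence⇒P₂ {k} {α@(a₀ ∷ a₁ ∷ a₂ ∷ a₃ ∷ a₄ ∷ [])} k≢0 α⋏w≡0 with ≡⇒Pointwise-≡ α⋏w≡0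
... | _ ∷ _ ∷ t₀₁₄ ∷ _ ∷ _ ∷ _ ∷ _ ∷ t₁₂₄ ∷ t₁₃₄ ∷ _ = a₁ , a₄ , Pointwise-≡⇒≡
  ( vanishing⇒≡ k≢0 t₀₁₄ (solve vars ℚ-ring)
  ∷ solve vars ℚ-ring
  ∷ sym (vanishing⇒≡ k≢0 t₁₂₄ (solve vars ℚ-ring))
  ∷ sym (vanishing⇒≡ k≢0 t₁₃₄ (solve vars ℚ-ring))
  ∷ solve vars ℚ-ring ∷ [])
  where
  vars : List ℚ
  vars = k ∷ toList α

incidence⇒P₃ : ∀ {k α} → k ≢ 0ℚ → α ⋏ relation 0ℚ 0ℚ k 0ℚ ≡ 0⃗ → InPlane ω₃ (ψ₁ ⊕ ψ₂) α
incidence⇒P₃ {k} {α@(a₀ ∷ a₁ ∷ a₂ ∷ a₃ ∷ a₄ ∷ [])} k≢0 α⋏w≡0 with ≡⇒Pointwise-≡ α⋏w≡0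
... | _ ∷ _ ∷ _ ∷ _ ∷ t₀₂₄ ∷ _ ∷ t₁₂₃ ∷ _ ∷ _ ∷ t₂₃₄ ∷ _ = a₂ , a₃ , Pointwise-≡⇒≡
  ( vanishing⇒≡ k≢0 t₀₂₄ (solve vars ℚ-ring)
  ∷ vanishing⇒≡ k≢0 t₁₂₃ (solve vars ℚ-ring)
  ∷ solve vars ℚ-ring
  ∷ solve vars ℚ-ring
  ∷ vanishing⇒≡ k≢0 t₂₃₄ (solve vars ℚ-ring) ∷ [])
  where
  vars : List ℚ
  vars = k ∷ toList α

incidence⇒P₄ : ∀ {k α} → k ≢ 0ℚ → α ⋏ relation k 0ℚ 0ℚ k ≡ 0⃗ → InPlane (ω₁ ⊖ ω₃) ((ω₁ ⊖ ω₂) ⊖ ψ₁) α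
incidence⇒P₄ {k} {α@(a₀ ∷ a₁ ∷ a₂ ∷ a₃ ∷ a₄ ∷ [])} k≢0 α⋏w≡0 with ≡⇒Pointwise-≡ α⋏w≡0
... | t₀₁₂ ∷ t₀₁₃ ∷ _ ∷ _ ∷ _ ∷ t₀₃₄ ∷ _ = - a₂ , - a₁ , Pointwise-≡⇒≡
  ( vanishing⇒≡ k≢0 t₀₁₂ (solve vars ℚ-ring)
  ∷ solve vars ℚ-ring
  ∷ solve vars ℚ-ring
  ∷ vanishing⇒≡ k≢0 t₀₁₃ (solve vars ℚ-ring)
  ∷ vanishing⇒≡ k≢0 t₀₃₄ (solve vars ℚ-ring) ∷ [])
  where
  vars : List ℚ
  vars = k ∷ toList α

incidence⇒P₅ : ∀ {k α} → k ≢ 0ℚ → α ⋏ relation 0ℚ (- k) k k ≡ 0⃗ → InPlane (ω₂ ⊖ ω₃) ((ω₁ ⊖ ω₂) ⊕ ψ₂) α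
incidence⇒P₅ {k} {α@(a₀ ∷ a₁ ∷ a₂ ∷ a₃ ∷ a₄ ∷ [])} k≢0 α⋏w≡0 with ≡⇒Pointwise-≡ α⋏w≡0
... | t₀₁₂ ∷ t₀₁₃ ∷ t₀₁₄ ∷ _ = - a₂ , a₀ , Pointwise-≡⇒≡
  ( solve vars ℚ-ring
  ∷ vanishing⇒≡ k≢0 t₀₁₂ (solve vars ℚ-ring)
  ∷ solve vars ℚ-ring
  ∷ vanishing⇒≡ k≢0 t₀₁₃ (solve vars ℚ-ring)
  ∷ vanishing⇒≡ k≢0 t₀₁₄ (solve vars ℚ-ring) ∷ [])
  where
  vars : List ℚ
  vars = k ∷ toList α

coefficients-unique : ∀ {u v a b c d} → u ∧ v ≢ 0⃗ → a · u ⊕ b · v ≡ c · u ⊕ d · v → a ≡ c × b ≡ d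
coefficients-unique {u} {v} {a} {b} {c} {d} u∧v≢0 eq = a≡c , b≡d
  where
  open ≡-Reasoning
  vars : List ℚ
  vars = a ∷ b ∷ c ∷ d ∷ []
  determinants : ∀ s t → a * t - b * s ≡ c * t - d * s
  determinants s t = ·-cancelʳ u∧v≢0 (begin
    (a * t - b * s) · (u ∧ v)         ≡⟨ sym (∧-of-combinations a b s t u v) ⟩
    (a · u ⊕ b · v) ∧ (s · u ⊕ t · v) ≡⟨ cong (_∧ (s · u ⊕ t · v)) eq ⟩
    (c · u ⊕ d · v) ∧ (s · u ⊕ t · v) ≡⟨ ∧-of-combinations c d s t u v ⟩
    (c * t - d * s) · (u ∧ v)         ∎)
  a≡c : a ≡ c
  a≡c = begin
    a                 ≡⟨ solve vars ℚ-ring ⟩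
    a * 1ℚ - b * 0ℚ   ≡⟨ determinants 0ℚ 1ℚ ⟩
    c * 1ℚ - d * 0ℚ   ≡⟨ solve vars ℚ-ring ⟩
    c                 ∎
  b≡d : b ≡ d
  b≡d = begin
    b                     ≡⟨ solve vars ℚ-ring ⟩
    - (a * 0ℚ - b * 1ℚ)   ≡⟨ cong -_ (determinants 1ℚ 0ℚ) ⟩
    - (c * 0ℚ - d * 1ℚ)   ≡⟨ solve vars ℚ-ring ⟩
    d                     ∎

record RelationPlane (u v : A¹) : Set where
  field
    bivector-is-relation : IsZero² (u ∧ v)
    bivector-nonzero     : u ∧ v ≢ 0⃗

combination-resonant : ∀ {u v} → RelationPlane u v → ∀ {a b} c d →
                       (∀ l → ¬ (c ≡ l * a × d ≡ l * b)) → InR¹ (a · u ⊕ b · v)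
combination-resonant {u} {v} plane {a} {b} c d not-proportional =
  c · u ⊕ d · v , in-kernel , not-in-image
  where
  open RelationPlane plane
  in-kernel : InKer¹ (a · u ⊕ b · v) (c · u ⊕ d · v)
  in-kernel = subst IsZero² (sym (∧-of-combinations a b c d u v))
                            (·-IsZero² (a * d - b * c) bivector-is-relation)
  not-in-image : ¬ InIm⁰ (a · u ⊕ b · v) (c · u ⊕ d · v)
  not-in-image (l , β≡lα) =
    not-proportional l (coefficients-unique bivector-nonzero (trans β≡lα (·-linear l a b u v)))

in-plane⇒resonant : ∀ {u v α} → RelationPlane u v → InPlane u v α → InR¹ α
in-plane⇒resonant plane (a , b , refl) with b ≟ 0ℚ
... | yes refl = combination-resonant plane {a} 0ℚ 1ℚ λ l (_ , 1≡l*0) → 1≢0 (trans 1≡l*0 (*-zeroʳ l))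
... | no b≢0   = combination-resonant plane {a} 1ℚ 0ℚ λ l (1≡l*a , 0≡l*b) →
  1≢0 (trans 1≡l*a (trans (cong (_* a) (l≡0 l 0≡l*b)) (*-zeroˡ a)))
  where
  l≡0 : ∀ l → 0ℚ ≡ l * b → l ≡ 0ℚ
  l≡0 l 0≡l*b = *-cancelʳ-≡ b≢0 (trans (sym 0≡l*b) (sym (*-zeroˡ b)))

P₁ : RelationPlane ω₁ ψ₁
P₁ = record { bivector-is-relation = 1ℚ , 0ℚ , 0ℚ , 0ℚ , refl ; bivector-nonzero = λ () }

P₂ : RelationPlane ω₂ ψ₂
P₂ = record { bivector-is-relation = 0ℚ , 1ℚ , 0ℚ , 0ℚ , refl ; bivector-nonzero = λ () }

P₃ : RelationPlane ω₃ (ψ₁ ⊕ ψ₂)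
P₃ = record { bivector-is-relation = 0ℚ , 0ℚ , 1ℚ , 0ℚ , refl ; bivector-nonzero = λ () }

P₄ : RelationPlane (ω₁ ⊖ ω₃) ((ω₁ ⊖ ω₂) ⊖ ψ₁)
P₄ = record { bivector-is-relation = - 1ℚ , 0ℚ , 0ℚ , - 1ℚ , refl ; bivector-nonzero = λ () }

P₅ : RelationPlane (ω₂ ⊖ ω₃) ((ω₁ ⊖ ω₂) ⊕ ψ₂)
P₅ = record { bivector-is-relation = 0ℚ , 1ℚ , - 1ℚ , - 1ℚ , refl ; bivector-nonzero = λ () }

in-planes⇒resonant : ∀ {α} → InUnionOfPlanes α → InR¹ α
in-planes⇒resonant (inj₁ p)                      = in-plane⇒resonant P₁ p
in-planes⇒resonant (inj₂ (inj₁ p))               = in-plane⇒resonant P₂ p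
in-planes⇒resonant (inj₂ (inj₂ (inj₁ p)))        = in-plane⇒resonant P₃ p
in-planes⇒resonant (inj₂ (inj₂ (inj₂ (inj₁ p)))) = in-plane⇒resonant P₄ p
in-planes⇒resonant (inj₂ (inj₂ (inj₂ (inj₂ p)))) = in-plane⇒resonant P₅ p

decomposable⇒in-planes : ∀ {α β c₁ c₂ c₃ c₄} → Decomposable c₁ c₂ c₃ c₄ →
                         α ∧ β ≡ relation c₁ c₂ c₃ c₄ → ¬ InIm⁰ α β → InUnionOfPlanes α
decomposable⇒in-planes {α} {β} zero α∧β≡0 β∉ℚα with ∧≡0⃗⇒dependent α β α∧β≡0
... | inj₁ refl  = inj₁ (0ℚ , 0ℚ , refl)
... | inj₂ β∈ℚα = ⊥-elim (β∉ℚα β∈ℚα)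
decomposable⇒in-planes (line₁ k≢0) α∧β≡w _ = inj₁ (incidence⇒P₁ k≢0 (incidence α∧β≡w))
decomposable⇒in-planes (line₂ k≢0) α∧β≡w _ = inj₂ (inj₁ (incidence⇒P₂ k≢0 (incidence α∧β≡w)))
decomposable⇒in-planes (line₃ k≢0) α∧β≡w _ = inj₂ (inj₂ (inj₁ (incidence⇒P₃ k≢0 (incidence α∧β≡w))))
decomposable⇒in-planes (line₄ k≢0) α∧β≡w _ = inj₂ (inj₂ (inj₂ (inj₁ (incidence⇒P₄ k≢0 (incidence α∧β≡w)))))
decomposable⇒in-planes (line₅ k≢0) α∧β≡w _ = inj₂ (inj₂ (inj₂ (inj₂ (incidence⇒P₅ k≢0 (incidence α∧β≡w)))))

resonant⇒in-planes : ∀ {α} → InR¹ α → InUnionOfPlanes α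
resonant⇒in-planes {α} (β , (c₁ , c₂ , c₃ , c₄ , α∧β≡Σcρ) , β∉ℚα) =
  decomposable⇒in-planes (plücker⇒decomposable plücker-vanishes) α∧β≡w β∉ℚα
  where
  α∧β≡w : α ∧ β ≡ relation c₁ c₂ c₃ c₄
  α∧β≡w = trans α∧β≡Σcρ (relation-expansion c₁ c₂ c₃ c₄)
  plücker-vanishes : plücker (relation c₁ c₂ c₃ c₄) ≡ 0⃗
  plücker-vanishes = trans (cong plücker (sym α∧β≡w)) (plücker-∧ α β)

lemma2p3 : (α : A¹) → InR¹ α ⇔ InUnionOfPlanes α
lemma2p3 α = mk⇔ resonant⇒in-planes in-planes⇒resonant
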